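{- Let $A$ be a meet-complemented lattice in which both $\Box a$ and $\Diamond a$ exist for every $a\in A$. Then for every $a\in A$ the following are equivalent: (i) $\Diamond\Box a\le\Box a$; (ii) $\Box a\le\Box\Box a$; (iii) $\Box a\vee\neg\Box a=1$; (iv) $\Box\Box a=\Box a$.
   Context: A meet-complemented lattice is a lattice $(A,\wedge,\vee)$, not necessarily distributive, such that for every $a\in A$ the element $\neg a=\max\{b\in A: a\wedge b\le c\text{ for all }c\in A\}$ exists; it is bounded, with least element $0$ and greatest element $1$. For $a\in A$, $\Box a=\max\{b\in A: a\vee\neg b=1\}$ and $\Diamond a=\min\{b\in A: \neg a\vee b=1\}$. -}

module Defs where

open import Level using (Level; _⊔_)
open import Data.Product using (_×_)
open import Relation.Binary.Lattice.Bundles using (BoundedLattice)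

IsMax : ∀ {c ℓ p} {A : Set c} → (A → A → Set ℓ) → (A → Set p) → A → Set (c ⊔ ℓ ⊔ p)
IsMax _≤_ P m = P m × (∀ b → P b → b ≤ m)

IsMin : ∀ {c ℓ p} {A : Set c} → (A → A → Set ℓ) → (A → Set p) → A → Set (c ⊔ ℓ ⊔ p)
IsMin _≤_ P m = P m × (∀ b → P b → m ≤ b)

module _ {c ℓ₁ ℓ₂} (L : BoundedLattice c ℓ₁ ℓ₂) where
  open BoundedLattice L

  IsMeetComplement : (Carrier → Carrier) → Set (c ⊔ ℓ₂)
  IsMeetComplement neg = ∀ a → IsMax _≤_ (λ b → ∀ x → (a ∧ b) ≤ x) (neg a)

  IsBox : (Carrier → Carrier) → (Carrier → Carrier) → Set (c ⊔ ℓ₁ ⊔ ℓ₂)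
  IsBox neg box = ∀ a → IsMax _≤_ (λ b → (a ∨ neg b) ≈ ⊤) (box a)

  IsDiamond : (Carrier → Carrier) → (Carrier → Carrier) → Set (c ⊔ ℓ₁ ⊔ ℓ₂)
  IsDiamond neg dia = ∀ a → IsMin _≤_ (λ b → (neg a ∨ b) ≈ ⊤) (dia a)

module Submission where

-- The equivalences are instances of facts about an ARBITRARY element b:
--   * b ≤ □b  ⇔  b ∨ ¬b = 1   (the defining property of □ together with
--     antitonicity of ¬), and
--   * ◇b ≤ b  ⇔  ¬b ∨ b = 1   (the defining property of ◇).
-- Taking b = □a gives (ii) ⇔ (iii) ⇔ (i).  For (iv) it suffices that □ is
-- deflationary on boxes, □□a ≤ □a, which follows from ¬x ≤ ¬□x; the latter
-- holds because □x ∧ ¬x is a least element (its complement is 1).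

open import Defs
open import Data.Product using (_×_; _,_; proj₁; proj₂)
open import Function.Bundles using (_⇔_; mk⇔)
open import Function.Properties.Equivalence using () renaming (sym to ⇔-sym; trans to ⇔-trans)
open import Relation.Binary.Lattice.Bundles using (BoundedLattice)
import Relation.Binary.Lattice.Properties.JoinSemilattice as JoinProperties

module _ {c ℓ₁ ℓ₂} (L : BoundedLattice c ℓ₁ ℓ₂) where
  open BoundedLattice L
  open JoinProperties joinSemilattice using (∨-monotonic; ∨-comm)

  ⊤-upward : ∀ {x y} → x ≈ ⊤ → x ≤ y → y ≈ ⊤
  ⊤-upward x≈⊤ x≤y = antisym (maximum _) (trans (reflexive (Eq.sym x≈⊤)) x≤y)

  ∨-⊤-monoʳ : ∀ {x y y′} → y ≤ y′ → x ∨ y ≈ ⊤ → x ∨ y′ ≈ ⊤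
  ∨-⊤-monoʳ y≤y′ e = ⊤-upward e (∨-monotonic refl y≤y′)

  ∨-⊤-comm : ∀ {x y} → x ∨ y ≈ ⊤ → y ∨ x ≈ ⊤
  ∨-⊤-comm {x} {y} e = Eq.trans (∨-comm y x) e

  ∧-swap : ∀ x y → x ∧ y ≤ y ∧ x
  ∧-swap x y = ∧-greatest (x∧y≤y x y) (x∧y≤x x y)

  module MeetComplement (neg : Carrier → Carrier) (negC : IsMeetComplement L neg) where

    ¬-greatest : ∀ {x y} → (∀ z → (x ∧ y) ≤ z) → y ≤ neg x
    ¬-greatest {x} {y} = proj₂ (negC x) y

    ∧¬-least : ∀ x z → (x ∧ neg x) ≤ z
    ∧¬-least x = proj₁ (negC x)

    ¬-anti : ∀ {x y} → x ≤ y → neg y ≤ neg x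
    ¬-anti {x} {y} x≤y = ¬-greatest λ z →
      trans (∧-greatest (trans (x∧y≤x x (neg y)) x≤y) (x∧y≤y x (neg y))) (∧¬-least y z)

    ≤¬¬ : ∀ x → x ≤ neg (neg x)
    ≤¬¬ x = ¬-greatest λ z →
      trans (∧-swap (neg x) x) (∧¬-least x z)

    ¬≈⊤⇒least : ∀ {y} → neg y ≈ ⊤ → ∀ z → y ≤ z
    ¬≈⊤⇒least {y} ¬y≈⊤ z =
      trans (∧-greatest refl (trans (maximum y) (reflexive (Eq.sym ¬y≈⊤)))) (∧¬-least y z)

  module Box (neg box : Carrier → Carrier)
             (negC : IsMeetComplement L neg) (boxC : IsBox L neg box) where
    open MeetComplement neg negC

    box-spec : ∀ x → x ∨ neg (box x) ≈ ⊤
    box-spec x = proj₁ (boxC x)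

    box-greatest : ∀ {x b} → x ∨ neg b ≈ ⊤ → b ≤ box x
    box-greatest {x} {b} = proj₂ (boxC x) b

    -- ¬x ∧ □x is a least element: its complement lies above both
    -- ¬¬x ≥ x and ¬□x, hence above x ∨ ¬□x = 1.
    ¬∧box-least : ∀ x z → (neg x ∧ box x) ≤ z
    ¬∧box-least x = ¬≈⊤⇒least (⊤-upward (box-spec x) x∨¬box≤¬y)
      where
      x∨¬box≤¬y : x ∨ neg (box x) ≤ neg (neg x ∧ box x)
      x∨¬box≤¬y = ∨-least (trans (≤¬¬ x) (¬-anti (x∧y≤x (neg x) (box x))))
                          (¬-anti (x∧y≤y (neg x) (box x)))

    ¬≤¬box : ∀ x → neg x ≤ neg (box x)
    ¬≤¬box x = ¬-greatest λ z →
      trans (∧-swap (box x) (neg x)) (¬∧box-least x z)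

    -- □ is deflationary on boxes: a ∨ ¬□a = 1 and ¬□a ≤ ¬□□a.
    boxbox≤box : ∀ a → box (box a) ≤ box a
    boxbox≤box a = box-greatest (∨-⊤-monoʳ (¬≤¬box (box a)) (box-spec a))

    ≤box⇔∨¬≈⊤ : ∀ b → (b ≤ box b) ⇔ (b ∨ neg b ≈ ⊤)
    ≤box⇔∨¬≈⊤ b = mk⇔ (λ b≤□b → ∨-⊤-monoʳ (¬-anti b≤□b) (box-spec b)) box-greatest

  module Diamond (neg dia : Carrier → Carrier) (diaC : IsDiamond L neg dia) where

    dia≤⇔∨¬≈⊤ : ∀ b → (dia b ≤ b) ⇔ (b ∨ neg b ≈ ⊤)
    dia≤⇔∨¬≈⊤ b = mk⇔
      (λ ◇b≤b → ∨-⊤-comm (∨-⊤-monoʳ ◇b≤b (proj₁ (diaC b))))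
      (λ e → proj₂ (diaC b) b (∨-⊤-comm e))

proposition17 : ∀ {c ℓ₁ ℓ₂} (L : BoundedLattice c ℓ₁ ℓ₂)
    (neg box dia : BoundedLattice.Carrier L → BoundedLattice.Carrier L) →
    IsMeetComplement L neg → IsBox L neg box → IsDiamond L neg dia →
    ∀ a →
    let open BoundedLattice L in
    ((dia (box a) ≤ box a) ⇔ (box a ≤ box (box a)))
    × ((box a ≤ box (box a)) ⇔ ((box a ∨ neg (box a)) ≈ ⊤))
    × (((box a ∨ neg (box a)) ≈ ⊤) ⇔ (box (box a) ≈ box a))
proposition17 L neg box dia negC boxC diaC a =
  ⇔-trans (dia≤⇔∨¬≈⊤ (box a)) (⇔-sym ii⇔iii) , ii⇔iii , ⇔-trans (⇔-sym ii⇔iii) ii⇔iv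
  where
  open BoundedLattice L
  open Box L neg box negC boxC using (≤box⇔∨¬≈⊤; boxbox≤box)
  open Diamond L neg dia diaC using (dia≤⇔∨¬≈⊤)

  ii⇔iii : (box a ≤ box (box a)) ⇔ (box a ∨ neg (box a) ≈ ⊤)
  ii⇔iii = ≤box⇔∨¬≈⊤ (box a)

  ii⇔iv : (box a ≤ box (box a)) ⇔ (box (box a) ≈ box a)
  ii⇔iv = mk⇔ (antisym (boxbox≤box a)) (λ e → reflexive (Eq.sym e))
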